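{- Let $p$ be a prime, $n\ge1$, and $g$ an integer with $g\not\equiv0\pmod{p^{n+1}}$. Then $$\pi_n\big(\operatorname{div}^\infty E_g^{(p^{n+1})}\big)=\begin{cases}\operatorname{div}^\infty E_g^{(p^n)},& p\nmid g,\\ p^2\operatorname{div}^\infty E^{(p^n)}_{g/p},& p\mid g.\end{cases}$$
   Context: For a positive integer $N$ and an integer $a\not\equiv0\pmod N$, put $q=e^{2\pi i\tau}$ and $E^{(N)}_a(\tau)=q^{NB(a/N)/2}\prod_{m\ge1}(1-q^{(m-1)N+a})(1-q^{mN-a})$, with $B(x)=x^2-x+1/6$; this is a modular unit on $\Gamma_1(N)$ and its order at a cusp $a'/c$ of $X_1(N)$ ($\gcd(a',c)=1$) is $\frac{(c,N)}2B_2\big(a'a/(c,N)\big)$, where $B_2(x)=\{x\}^2-\{x\}+1/6$ and $\{x\}$ is the fractional part. Let $p$ be a prime, $X_n=X_1(p^{n+1})$, and $C_n$ the set of cusps $k/p^{n+1}$ with $\gcd(k,p)=1$. For a modular function $f$ on $X_n$, $\operatorname{div}^\infty f=\sum_{P\in C_n}\operatorname{ord}_P(f)\,P$. For $n\ge1$, $\pi_n$ is the homomorphism from divisors supported on $C_n$ to divisors supported on $C_{n-1}$ induced by the covering $X_n\to X_{n-1}$, sending the cusp $k/p^{n+1}$ to $k/p^n$. -}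

module Defs where

open import Data.Nat as ℕ using (ℕ; NonZero; _^_)
open import Data.Nat.Properties using (m^n≢0)
open import Data.Nat.Primality using (Prime; prime⇒nonZero)
open import Data.Nat.Coprimality using (coprime?)
open import Data.Nat.Divisibility using (_∣?_)
open import Data.Integer as ℤ using (ℤ; +_)
open import Data.Rational as ℚ using (ℚ; 0ℚ; floor; _+_; _-_; _*_; _/_)
open import Data.List using (List; upTo; filter; map; foldr)
open import Relation.Nullary.Decidable using (_×-dec_)

B₂ : ℚ → ℚ
B₂ x = let f = x - (floor x / 1) in f * f - f + (+ 1 / 6)

-- Order of the modular unit E_a^{(N)} at the cusp k/N of X₁(N), N = p^m
-- (here c = N, so (c,N) = N):  ord = (N/2) · B₂(k a / N)
ordE : (p : ℕ) → Prime p → (m : ℕ) → (a : ℤ) → (k : ℕ) → ℚ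
ordE p pp m a k = (+ (p ^ m) / 2) * B₂ ((+ k ℤ.* a) / (p ^ m))
  where instance
    _ : NonZero p
    _ = prime⇒nonZero pp
    _ : NonZero (p ^ m)
    _ = m^n≢0 p m

-- Divisors supported on C_{m-1} (cusps k/p^m, p ∤ k) are represented as
-- functions ℕ → ℚ: D k is the coefficient of the cusp k/p^m (0 ≤ k < p^m,
-- gcd(k,p)=1); values at other k are irrelevant.
Div : Set
Div = ℕ → ℚ

divInf : (p : ℕ) → Prime p → (m : ℕ) → (a : ℤ) → Div
divInf p pp m a k = ordE p pp m a k

sumℚ : List ℚ → ℚ
sumℚ = foldr _+_ 0ℚ

-- π_n : divisors on C_n (cusps k/p^{n+1}) → divisors on C_{n-1} (cusps k'/p^n),
-- induced by k/p^{n+1} ↦ k/p^n.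
π : (p n : ℕ) → Div → Div
π p n D k' =
  sumℚ (map D (filter (λ k → coprime? k p ×-dec (p ^ n ∣? ℤ.∣ + k ℤ.- + k' ∣))
                      (upTo (p ^ ℕ.suc n))))

-- The cusps of X_n lying over k/p^n are the p cusps (jM + k)/pM, j < p, where M = p^n,
-- so π_n sums the orders (pM/2)·B₂((jM + k) g / pM) over j < p.  If g = p h, every
-- summand equals p·(M/2)·B₂(k h / M) because B₂ has period 1.  If p ∤ g, write
-- k g = s + q M with 0 ≤ s < M; the fractional part of (jM + k) g / pM is (s/M + τ_j)/p,
-- where τ_j ≡ q + j g (mod p) runs over all residues mod p as j does.  The
-- multiplication formula Σ_{t<p} B₂((x + t)/p) = B₂(x)/p then gives (M/2)·B₂(s/M).
module Submission where

open import Defs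
open import Data.Nat using (ℕ; suc; _≤_; _<_; _^_)
open import Data.Nat.Primality using (Prime)
open import Data.Nat.Coprimality using (Coprime)
open import Data.Integer using (ℤ; +_) renaming (_*_ to _*ℤ_)
open import Data.Integer.Divisibility using (_∣_)
open import Data.Rational using (ℚ; _*_; _/_)
open import Data.Product using (_×_)
open import Relation.Nullary using (¬_)
open import Relation.Binary.PropositionalEquality using (_≡_)

open import Algebra.Bundles using (Ring)
open import Data.Fin using (Fin; toℕ; fromℕ<; punchOut)
import Data.Fin.Properties as FinP
open import Data.Fin.Permutation using (Permutation; permutation)
open import Data.Integer as ℤ using (1ℤ)
import Data.Integer.DivMod as ℤD
import Data.Integer.Divisibility.Signed as ℤS
import Data.Integer.GCD as ℤG
import Data.Integer.Properties as ℤP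
open import Data.Integer.Tactic.RingSolver using (solve-∀)
open import Data.List using ([]; _∷_; [_]; _++_; upTo; filter; map)
import Data.List.Properties as ListP
open import Data.Nat as ℕ using (zero; NonZero; _∸_)
open import Data.Nat.Coprimality using (coprime?)
open import Data.Nat.Divisibility as ℕD using (_∣?_)
import Data.Nat.DivMod as ℕDM
import Data.Nat.GCD as ℕG
open import Data.Nat.Primality using (prime⇒nonZero; euclidsLemma)
import Data.Nat.Properties as ℕP
import Data.Nat.Tactic.RingSolver as ℕSolver
open import Data.Product using (∃; _,_; proj₁; proj₂)
open import Data.Rational using (_+_; _-_; -_; 0ℚ; 1ℚ; ↥_; ↧_; floor; toℚᵘ)
import Data.Rational.Properties as ℚP
open import Data.Rational.Solver using (module +-*-Solver)
import Data.Rational.Unnormalised as ℚᵘ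
import Data.Rational.Unnormalised.Properties as ℚᵘP
open import Data.Sum using (inj₁; inj₂)
open import Function using (_∘_)
open import Function.Definitions using (Injective)
open import Relation.Binary.PropositionalEquality
  using (refl; sym; trans; cong; cong₂; subst; _≢_; module ≡-Reasoning)
open import Relation.Nullary using (yes; no; contradiction)
open import Relation.Nullary.Decidable using (_×-dec_)
open import Relation.Unary using (Decidable)

open import Algebra.Properties.CommutativeMonoid.Sum ℚP.+-0-commutativeMonoid
  using (sum; sum-cong-≗; sum-init-last; sum-permute)
open import Algebra.Properties.Semiring.Sum (Ring.semiring ℚP.+-*-ring) using (*-distribˡ-sum)

toℚᵘ-/ : ∀ a n .{{_ : NonZero n}} → toℚᵘ (a / n) ℚᵘ.≃ (a ℚᵘ./ n)
toℚᵘ-/ a (suc n) = ℚP.toℚᵘ-fromℚᵘ (ℚᵘ.mkℚᵘ a n)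

*≡*⇒/≡/ : ∀ a b m n .{{_ : NonZero m}} .{{_ : NonZero n}} →
          a ℤ.* + n ≡ b ℤ.* + m → a / m ≡ b / n
*≡*⇒/≡/ a b m@(suc _) n@(suc _) eq = ℚP.toℚᵘ-injective
  (ℚᵘP.≃-trans (toℚᵘ-/ a m) (ℚᵘP.≃-trans (ℚᵘ.*≡* eq) (ℚᵘP.≃-sym (toℚᵘ-/ b n))))

/-+-/ : ∀ a b m n .{{_ : NonZero m}} .{{_ : NonZero n}} .{{_ : NonZero (m ℕ.* n)}} →
        a / m + b / n ≡ (a ℤ.* + n ℤ.+ b ℤ.* + m) / (m ℕ.* n)
/-+-/ a b m@(suc _) n@(suc _) = ℚP.toℚᵘ-injective
  (ℚᵘP.≃-trans (ℚP.toℚᵘ-homo-+ (a / m) (b / n))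
  (ℚᵘP.≃-trans (ℚᵘP.+-cong (toℚᵘ-/ a m) (toℚᵘ-/ b n))
               (ℚᵘP.≃-sym (toℚᵘ-/ (a ℤ.* + n ℤ.+ b ℤ.* + m) (m ℕ.* n)))))

/-*-/ : ∀ a b m n .{{_ : NonZero m}} .{{_ : NonZero n}} .{{_ : NonZero (m ℕ.* n)}} →
        (a / m) * (b / n) ≡ (a ℤ.* b) / (m ℕ.* n)
/-*-/ a b m@(suc _) n@(suc _) = ℚP.toℚᵘ-injective
  (ℚᵘP.≃-trans (ℚP.toℚᵘ-homo-* (a / m) (b / n))
  (ℚᵘP.≃-trans (ℚᵘP.*-cong (toℚᵘ-/ a m) (toℚᵘ-/ b n))
               (ℚᵘP.≃-sym (toℚᵘ-/ (a ℤ.* b) (m ℕ.* n)))))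

-‿/ : ∀ a n .{{_ : NonZero n}} → - (a / n) ≡ (ℤ.- a) / n
-‿/ a n@(suc _) = ℚP.toℚᵘ-injective
  (ℚᵘP.≃-trans (ℚP.toℚᵘ-homo‿- (a / n))
  (ℚᵘP.≃-trans (ℚᵘP.-‿cong (toℚᵘ-/ a n)) (ℚᵘP.≃-sym (toℚᵘ-/ (ℤ.- a) n))))

ι : ℤ → ℚ
ι a = a / 1

ι-+ : ∀ a b → ι (a ℤ.+ b) ≡ ι a + ι b
ι-+ a b = sym (trans (/-+-/ a b 1 1) (*≡*⇒/≡/ (a ℤ.* 1ℤ ℤ.+ b ℤ.* 1ℤ) (a ℤ.+ b) 1 1 (identity a b)))
  where
  identity : ∀ a b → (a ℤ.* 1ℤ ℤ.+ b ℤ.* 1ℤ) ℤ.* 1ℤ ≡ (a ℤ.+ b) ℤ.* 1ℤ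
  identity = solve-∀

n*[1/n]≡1 : ∀ n .{{_ : NonZero n}} → ι (+ n) * (+ 1 / n) ≡ 1ℚ
n*[1/n]≡1 n = trans (/-*-/ (+ n) (+ 1) 1 n) (*≡*⇒/≡/ (+ n ℤ.* + 1) (+ 1) (1 ℕ.* n) 1 (begin
  + n ℤ.* + 1 ℤ.* + 1  ≡⟨ ℤP.*-identityʳ (+ n ℤ.* + 1) ⟩
  + n ℤ.* + 1          ≡⟨ ℤP.*-identityʳ (+ n) ⟩
  + n                  ≡⟨ cong +_ (sym (ℕP.*-identityˡ n)) ⟩
  + (1 ℕ.* n)          ≡⟨ sym (ℤP.*-identityˡ (+ (1 ℕ.* n))) ⟩
  + 1 ℤ.* + (1 ℕ.* n)  ∎))
  where
  open ≡-Reasoning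
  instance
    1*n≢0 : NonZero (1 ℕ.* n)
    1*n≢0 = ℕP.m*n≢0 1 n

[mn]/2≡m*[n/2] : ∀ m n → + (m ℕ.* n) / 2 ≡ ι (+ m) * (+ n / 2)
[mn]/2≡m*[n/2] m n = sym (trans (/-*-/ (+ m) (+ n) 1 2)
  (*≡*⇒/≡/ (+ m ℤ.* + n) (+ (m ℕ.* n)) 2 2 (cong (ℤ._* + 2) (sym (ℤP.pos-* m n)))))

[s+tM]/[pM]≡[s/M+t]/p : ∀ p M s t .{{_ : NonZero p}} .{{_ : NonZero M}} .{{_ : NonZero (p ℕ.* M)}} →
  + (s ℕ.+ t ℕ.* M) / (p ℕ.* M) ≡ (+ s / M + ι (+ t)) * (+ 1 / p)
[s+tM]/[pM]≡[s/M+t]/p p M s t = sym (begin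
  (+ s / M + + t / 1) * (+ 1 / p)  ≡⟨ cong (_* (+ 1 / p)) (/-+-/ (+ s) (+ t) M 1) ⟩
  a / (M ℕ.* 1) * (+ 1 / p)        ≡⟨ /-*-/ a (+ 1) (M ℕ.* 1) p ⟩
  (a ℤ.* + 1) / (M ℕ.* 1 ℕ.* p)    ≡⟨ *≡*⇒/≡/ (a ℤ.* + 1) (+ (s ℕ.+ t ℕ.* M)) (M ℕ.* 1 ℕ.* p) (p ℕ.* M) cross ⟩
  + (s ℕ.+ t ℕ.* M) / (p ℕ.* M)    ∎)
  where
  open ≡-Reasoning
  instance
    M*1≢0 : NonZero (M ℕ.* 1)
    M*1≢0 = ℕP.m*n≢0 M 1
    M*1*p≢0 : NonZero (M ℕ.* 1 ℕ.* p)
    M*1*p≢0 = ℕP.m*n≢0 (M ℕ.* 1) p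
  a : ℤ
  a = + s ℤ.* + 1 ℤ.+ + t ℤ.* + M
  identity : ∀ s t M p → (s ℤ.* + 1 ℤ.+ t ℤ.* M) ℤ.* + 1 ℤ.* (p ℤ.* M) ≡ (s ℤ.+ t ℤ.* M) ℤ.* (M ℤ.* + 1 ℤ.* p)
  identity = solve-∀
  cross : a ℤ.* + 1 ℤ.* + (p ℕ.* M) ≡ + (s ℕ.+ t ℕ.* M) ℤ.* + (M ℕ.* 1 ℕ.* p)
  cross = begin
    a ℤ.* + 1 ℤ.* + (p ℕ.* M)                        ≡⟨ cong (a ℤ.* + 1 ℤ.*_) (ℤP.pos-* p M) ⟩
    a ℤ.* + 1 ℤ.* (+ p ℤ.* + M)                      ≡⟨ identity (+ s) (+ t) (+ M) (+ p) ⟩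
    (+ s ℤ.+ + t ℤ.* + M) ℤ.* (+ M ℤ.* + 1 ℤ.* + p)  ≡⟨ cong₂ ℤ._*_
      (sym (trans (ℤP.pos-+ s (t ℕ.* M)) (cong (λ z → + s ℤ.+ z) (ℤP.pos-* t M))))
      (sym (trans (ℤP.pos-* (M ℕ.* 1) p) (cong (ℤ._* + p) (ℤP.pos-* M 1)))) ⟩
    + (s ℕ.+ t ℕ.* M) ℤ.* + (M ℕ.* 1 ℕ.* p)          ∎

i<suc[j]⇒i≤j : ∀ {i j} → i ℤ.< ℤ.suc j → i ℤ.≤ j
i<suc[j]⇒i≤j {j = j} i<sj = ℤP.≤-trans (ℤP.i<j⇒i≤pred[j] i<sj) (ℤP.≤-reflexive (ℤP.pred-suc j))

/ℕ-unique : ∀ a d .{{_ : NonZero d}} q →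
            q ℤ.* + d ℤ.≤ a → a ℤ.< ℤ.suc q ℤ.* + d → a ℤD./ℕ d ≡ q
/ℕ-unique a d q lower upper = ℤP.≤-antisym
  (i<suc[j]⇒i≤j (ℤP.*-cancelʳ-<-nonNeg (+ d) (ℤP.≤-<-trans (ℤD.[n/ℕd]*d≤n a d) upper)))
  (i<suc[j]⇒i≤j (ℤP.*-cancelʳ-<-nonNeg (+ d) (ℤP.≤-<-trans lower (ℤD.n<s[n/ℕd]*d a d))))

floor-unique : ∀ x q → q ℤ.* ↧ x ℤ.≤ ↥ x → ↥ x ℤ.< ℤ.suc q ℤ.* ↧ x → floor x ≡ q
floor-unique x@record{} q lower upper =
  trans (ℤD.div-pos-is-/ℕ (↥ x) _) (/ℕ-unique (↥ x) _ q lower upper)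

-- The bounds for a / N scale to those for its reduced form by g = gcd(a, N) > 0.
floor-/ : ∀ a q r N .{{_ : NonZero N}} → r < N → a ≡ + r ℤ.+ q ℤ.* + N → floor (a / N) ≡ q
floor-/ a q r N r<N a≡r+qN = floor-unique x q
  (ℤP.*-cancelʳ-≤-pos (q ℤ.* ↧ x) (↥ x) g (begin
    q ℤ.* ↧ x ℤ.* g   ≡⟨ ℤP.*-assoc q (↧ x) g ⟩
    q ℤ.* (↧ x ℤ.* g) ≡⟨ cong (q ℤ.*_) (ℚP.↧-/ a N) ⟩
    q ℤ.* + N         ≤⟨ ℤP.i≤j+i (q ℤ.* + N) (+ r) ⟩
    + r ℤ.+ q ℤ.* + N ≡⟨ sym a≡r+qN ⟩
    a                 ≡⟨ sym (ℚP.↥-/ a N) ⟩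
    ↥ x ℤ.* g         ∎))
  (ℤP.*-cancelʳ-<-nonNeg g (begin-strict
    ↥ x ℤ.* g                ≡⟨ ℚP.↥-/ a N ⟩
    a                        ≡⟨ a≡r+qN ⟩
    + r ℤ.+ q ℤ.* + N        <⟨ ℤP.+-monoˡ-< (q ℤ.* + N) (ℤ.+<+ r<N) ⟩
    + N ℤ.+ q ℤ.* + N        ≡⟨ sym (ℤP.suc-* q (+ N)) ⟩
    ℤ.suc q ℤ.* + N          ≡⟨ cong (ℤ.suc q ℤ.*_) (sym (ℚP.↧-/ a N)) ⟩
    ℤ.suc q ℤ.* (↧ x ℤ.* g)  ≡⟨ sym (ℤP.*-assoc (ℤ.suc q) (↧ x) g) ⟩
    ℤ.suc q ℤ.* ↧ x ℤ.* g    ∎))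
  where
  open ℤP.≤-Reasoning
  x : ℚ
  x = a / N
  g : ℤ
  g = ℤG.gcd a (+ N)
  instance
    g-pos : ℤ.Positive g
    g-pos = ℤ.positive (ℤ.+<+ (ℕP.n≢0⇒n>0 (ℕG.gcd[m,n]≢0 ℤ.∣ a ∣ N (inj₂ (ℕ.≢-nonZero⁻¹ N)))))

fractional-part-/ : ∀ a q r N .{{_ : NonZero N}} → a ≡ + r ℤ.+ q ℤ.* + N →
                    a / N - ι q ≡ + r / N
fractional-part-/ a q r N refl = begin
  a / N + - ι q                               ≡⟨ cong (λ z → a / N + z) (-‿/ q 1) ⟩
  a / N + (ℤ.- q) / 1                         ≡⟨ /-+-/ a (ℤ.- q) N 1 ⟩
  (a ℤ.* + 1 ℤ.+ ℤ.- q ℤ.* + N) / (N ℕ.* 1)   ≡⟨ *≡*⇒/≡/ (a ℤ.* + 1 ℤ.+ ℤ.- q ℤ.* + N) (+ r) (N ℕ.* 1) N cross ⟩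
  + r / N                                     ∎
  where
  open ≡-Reasoning
  instance
    N*1≢0 : NonZero (N ℕ.* 1)
    N*1≢0 = ℕP.m*n≢0 N 1
  identity : ∀ r q n → ((r ℤ.+ q ℤ.* n) ℤ.* 1ℤ ℤ.+ ℤ.- q ℤ.* n) ℤ.* n ≡ r ℤ.* (n ℤ.* 1ℤ)
  identity = solve-∀
  cross : (a ℤ.* + 1 ℤ.+ ℤ.- q ℤ.* + N) ℤ.* + N ≡ + r ℤ.* + (N ℕ.* 1)
  cross = trans (identity (+ r) q (+ N)) (cong (+ r ℤ.*_) (sym (ℤP.pos-* N 1)))

½ ⅙ : ℚ
½ = + 1 / 2
⅙ = + 1 / 6

bernoulli₂ : ℚ → ℚ
bernoulli₂ x = x * x - x + ⅙

B₂-/ : ∀ a q r N .{{_ : NonZero N}} → r < N → a ≡ + r ℤ.+ q ℤ.* + N →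
       B₂ (a / N) ≡ bernoulli₂ (+ r / N)
B₂-/ a q r N r<N a≡r+qN = cong bernoulli₂ (begin
  a / N - ι (floor (a / N)) ≡⟨ cong (λ z → a / N - ι z) (floor-/ a q r N r<N a≡r+qN) ⟩
  a / N - ι q               ≡⟨ fractional-part-/ a q r N a≡r+qN ⟩
  + r / N                   ∎)
  where open ≡-Reasoning

B₂-periodic : ∀ a c N .{{_ : NonZero N}} → B₂ ((a ℤ.+ c ℤ.* + N) / N) ≡ B₂ (a / N)
B₂-periodic a c N = trans
  (B₂-/ (a ℤ.+ c ℤ.* + N) (q ℤ.+ c) r N r<N (trans (cong (ℤ._+ c ℤ.* + N) a≡r+qN) (shift (+ r) q c (+ N))))
  (sym (B₂-/ a q r N r<N a≡r+qN))
  where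
  r : ℕ
  r = a ℤD.%ℕ N
  q : ℤ
  q = a ℤD./ℕ N
  r<N : r < N
  r<N = ℤD.n%ℕd<d a N
  a≡r+qN : a ≡ + r ℤ.+ q ℤ.* + N
  a≡r+qN = ℤD.a≡a%ℕn+[a/ℕn]*n a N
  shift : ∀ r q c n → r ℤ.+ q ℤ.* n ℤ.+ c ℤ.* n ≡ r ℤ.+ (q ℤ.+ c) ℤ.* n
  shift = solve-∀

∑< : ℕ → (ℕ → ℚ) → ℚ
∑< m f = sum {m} (f ∘ toℕ)

∑<-suc : ∀ m f → ∑< (suc m) f ≡ ∑< m f + f m
∑<-suc m f = trans (sum-init-last {m} (f ∘ toℕ))
  (cong₂ _+_ (sum-cong-≗ {m} (cong f ∘ FinP.toℕ-inject₁)) (cong f (FinP.toℕ-fromℕ m)))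

∑<-cong : ∀ m {f g} → (∀ t → f t ≡ g t) → ∑< m f ≡ ∑< m g
∑<-cong m f≗g = sum-cong-≗ {m} (f≗g ∘ toℕ)

∑<-const : ∀ m c → ∑< m (λ _ → c) ≡ ι (+ m) * c
∑<-const zero    c = sym (ℚP.*-zeroˡ c)
∑<-const (suc m) c = begin
  c + ∑< m (λ _ → c)    ≡⟨ cong (λ s → c + s) (∑<-const m c) ⟩
  c + ι (+ m) * c       ≡⟨ cong (_+ ι (+ m) * c) (sym (ℚP.*-identityˡ c)) ⟩
  1ℚ * c + ι (+ m) * c  ≡⟨ sym (ℚP.*-distribʳ-+ c 1ℚ (ι (+ m))) ⟩
  (1ℚ + ι (+ m)) * c    ≡⟨ cong (_* c) (sym (ι-+ (+ 1) (+ m))) ⟩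
  ι (+ suc m) * c       ∎
  where open ≡-Reasoning

*-distribˡ-∑< : ∀ m c f → c * ∑< m f ≡ ∑< m (λ t → c * f t)
*-distribˡ-∑< m c f = *-distribˡ-sum {m} c (f ∘ toℕ)

injective⇒surjective : ∀ {n} (σ : Fin n → Fin n) → Injective _≡_ _≡_ σ → ∀ t → ∃ λ j → σ j ≡ t
injective⇒surjective {zero}  σ σ-inj ()
injective⇒surjective {suc n} σ σ-inj t with FinP.any? (λ j → σ j FinP.≟ t)
... | yes hit = hit
... | no miss = contradiction (FinP.injective⇒≤ punchOut∘σ-inj) (ℕP.<-irrefl refl)
  where
  σ≢t : ∀ j → t ≢ σ j
  σ≢t j t≡σj = miss (j , sym t≡σj)
  punchOut∘σ-inj : Injective _≡_ _≡_ (λ j → punchOut (σ≢t j))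
  punchOut∘σ-inj {j} {j′} eq = σ-inj (FinP.punchOut-injective (σ≢t j) (σ≢t j′) eq)

∑<-permute : ∀ m f (τ : ℕ → ℕ) → (∀ j → j < m → τ j < m) →
             (∀ {j j′} → j < m → j′ < m → τ j ≡ τ j′ → j ≡ j′) →
             ∑< m (f ∘ τ) ≡ ∑< m f
∑<-permute m f τ τ<m τ-inj = begin
  ∑< m (f ∘ τ)       ≡⟨ sum-cong-≗ {m} (λ i → cong f (sym (FinP.toℕ-fromℕ< (τ<m (toℕ i) (FinP.toℕ<n i))))) ⟩
  sum (f ∘ toℕ ∘ σ)  ≡⟨ sym (sum-permute (f ∘ toℕ) σ-perm) ⟩
  ∑< m f             ∎
  where
  open ≡-Reasoning
  σ : Fin m → Fin m
  σ i = fromℕ< (τ<m (toℕ i) (FinP.toℕ<n i))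
  σ-inj : Injective _≡_ _≡_ σ
  σ-inj {i} {i′} σi≡σi′ = FinP.toℕ-injective (τ-inj (FinP.toℕ<n i) (FinP.toℕ<n i′) (begin
    τ (toℕ i)   ≡⟨ sym (FinP.toℕ-fromℕ< (τ<m (toℕ i) (FinP.toℕ<n i))) ⟩
    toℕ (σ i)   ≡⟨ cong toℕ σi≡σi′ ⟩
    toℕ (σ i′)  ≡⟨ FinP.toℕ-fromℕ< (τ<m (toℕ i′) (FinP.toℕ<n i′)) ⟩
    τ (toℕ i′)  ∎))
  σ-onto : ∀ t → ∃ λ i → σ i ≡ t
  σ-onto = injective⇒surjective σ σ-inj
  σ-perm : Permutation m m
  σ-perm = permutation σ (proj₁ ∘ σ-onto) (proj₂ ∘ σ-onto) (σ-inj ∘ proj₂ ∘ σ-onto ∘ σ)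

-- The multiplication formula for B₂

open +-*-Solver using (Polynomial; con; _:+_; _:*_; _:-_; _:=_; solve)

bernoulli₂ᴾ : ∀ {n} → Polynomial n → Polynomial n
bernoulli₂ᴾ x = x :* x :- x :+ con ⅙

-- Summing B₂((x + t) e) = B₂(x e) + (2 x e - 1) e t + e² t² over t < X.
bernoulli₂-shifted-sum : ℚ → ℚ → ℚ → ℚ
bernoulli₂-shifted-sum x e X = X * bernoulli₂ (x * e)
  + (ι (+ 2) * x * e - 1ℚ) * e * (X * (X - 1ℚ) * ½)
  + e * e * (X * (X - 1ℚ) * (ι (+ 2) * X - 1ℚ) * ⅙)

bernoulli₂-shifted-sumᴾ : ∀ {n} → Polynomial n → Polynomial n → Polynomial n → Polynomial n
bernoulli₂-shifted-sumᴾ x e X = X :* bernoulli₂ᴾ (x :* e)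
  :+ (con (ι (+ 2)) :* x :* e :- con 1ℚ) :* e :* (X :* (X :- con 1ℚ) :* con ½)
  :+ e :* e :* (X :* (X :- con 1ℚ) :* (con (ι (+ 2)) :* X :- con 1ℚ) :* con ⅙)

∑<-bernoulli₂-shifted : ∀ m x e →
  ∑< m (λ t → bernoulli₂ ((x + ι (+ t)) * e)) ≡ bernoulli₂-shifted-sum x e (ι (+ m))
∑<-bernoulli₂-shifted zero x e =
  solve 2 (λ x e → con 0ℚ := bernoulli₂-shifted-sumᴾ x e (con 0ℚ)) refl x e
∑<-bernoulli₂-shifted (suc m) x e = begin
  ∑< (suc m) f                                            ≡⟨ ∑<-suc m f ⟩
  ∑< m f + f m                                            ≡⟨ cong (_+ f m) (∑<-bernoulli₂-shifted m x e) ⟩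
  bernoulli₂-shifted-sum x e X + bernoulli₂ ((x + X) * e) ≡⟨ step x e X ⟩
  bernoulli₂-shifted-sum x e (1ℚ + X)                     ≡⟨ cong (bernoulli₂-shifted-sum x e) (sym (ι-+ (+ 1) (+ m))) ⟩
  bernoulli₂-shifted-sum x e (ι (+ suc m))                ∎
  where
  open ≡-Reasoning
  f : ℕ → ℚ
  f t = bernoulli₂ ((x + ι (+ t)) * e)
  X : ℚ
  X = ι (+ m)
  step : ∀ x e X → bernoulli₂-shifted-sum x e X + bernoulli₂ ((x + X) * e) ≡ bernoulli₂-shifted-sum x e (1ℚ + X)
  step = solve 3 (λ x e X → bernoulli₂-shifted-sumᴾ x e X :+ bernoulli₂ᴾ ((x :+ X) :* e)
                          := bernoulli₂-shifted-sumᴾ x e (con 1ℚ :+ X)) refl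

bernoulli₂-multiplication : ∀ m x e → ι (+ m) * e ≡ 1ℚ →
  ι (+ m) * ∑< m (λ t → bernoulli₂ ((x + ι (+ t)) * e)) ≡ bernoulli₂ x
bernoulli₂-multiplication m x e me≡1 = begin
  X * ∑< m (λ t → bernoulli₂ ((x + ι (+ t)) * e)) ≡⟨ cong (X *_) (∑<-bernoulli₂-shifted m x e) ⟩
  X * bernoulli₂-shifted-sum x e X                ≡⟨ expand x e X ⟩
  G x X (X * e)                                   ≡⟨ cong (G x X) me≡1 ⟩
  G x X 1ℚ                                        ≡⟨ collapse x X ⟩
  bernoulli₂ x                                    ∎
  where
  open ≡-Reasoning
  X : ℚ
  X = ι (+ m)
  -- X times the closed form, with e occurring only through u = X e.
  G : ℚ → ℚ → ℚ → ℚ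
  G x X u = x * x * u * u - X * x * u + X * X * ⅙
    + (ι (+ 2) * x * u - X) * u * (X - 1ℚ) * ½
    + u * u * (X - 1ℚ) * (ι (+ 2) * X - 1ℚ) * ⅙
  Gᴾ : ∀ {n} → Polynomial n → Polynomial n → Polynomial n → Polynomial n
  Gᴾ x X u = x :* x :* u :* u :- X :* x :* u :+ X :* X :* con ⅙
    :+ (con (ι (+ 2)) :* x :* u :- X) :* u :* (X :- con 1ℚ) :* con ½
    :+ u :* u :* (X :- con 1ℚ) :* (con (ι (+ 2)) :* X :- con 1ℚ) :* con ⅙
  expand : ∀ x e X → X * bernoulli₂-shifted-sum x e X ≡ G x X (X * e)
  expand = solve 3 (λ x e X → X :* bernoulli₂-shifted-sumᴾ x e X := Gᴾ x X (X :* e)) refl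
  collapse : ∀ x X → G x X 1ℚ ≡ bernoulli₂ x
  collapse = solve 2 (λ x X → Gᴾ x X (con 1ℚ) := bernoulli₂ᴾ x) refl

-- The fibres of π

sumℚ-++ : ∀ xs ys → sumℚ (xs ++ ys) ≡ sumℚ xs + sumℚ ys
sumℚ-++ []       ys = sym (ℚP.+-identityˡ (sumℚ ys))
sumℚ-++ (x ∷ xs) ys = trans (cong (λ s → x + s) (sumℚ-++ xs ys)) (sym (ℚP.+-assoc x (sumℚ xs) (sumℚ ys)))

module FilteredSum {P : ℕ → Set} (P? : Decidable P) (D : ℕ → ℚ) where

  filteredSum : ℕ → ℚ
  filteredSum L = sumℚ (map D (filter P? (upTo L)))

  filteredSum-suc : ∀ L → filteredSum (suc L) ≡ filteredSum L + sumℚ (map D (filter P? [ L ]))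
  filteredSum-suc L = begin
    sumℚ (map D (filter P? (upTo (suc L))))
      ≡⟨ cong (sumℚ ∘ map D ∘ filter P?) (sym (ListP.upTo-∷ʳ L)) ⟩
    sumℚ (map D (filter P? (upTo L ++ [ L ])))
      ≡⟨ cong (sumℚ ∘ map D) (ListP.filter-++ P? (upTo L) [ L ]) ⟩
    sumℚ (map D (filter P? (upTo L) ++ filter P? [ L ]))
      ≡⟨ cong sumℚ (ListP.map-++ D (filter P? (upTo L)) (filter P? [ L ])) ⟩
    sumℚ (map D (filter P? (upTo L)) ++ map D (filter P? [ L ]))
      ≡⟨ sumℚ-++ (map D (filter P? (upTo L))) (map D (filter P? [ L ])) ⟩
    filteredSum L + sumℚ (map D (filter P? [ L ])) ∎
    where open ≡-Reasoning

  filteredSum-accept : ∀ {L} → P L → filteredSum (suc L) ≡ filteredSum L + D L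
  filteredSum-accept {L} PL = trans (filteredSum-suc L)
    (trans (cong (λ xs → filteredSum L + sumℚ (map D xs)) (ListP.filter-accept P? {xs = []} PL))
           (cong (λ s → filteredSum L + s) (ℚP.+-identityʳ (D L))))

  filteredSum-reject : ∀ {L} → ¬ P L → filteredSum (suc L) ≡ filteredSum L
  filteredSum-reject {L} ¬PL = trans (filteredSum-suc L)
    (trans (cong (λ xs → filteredSum L + sumℚ (map D xs)) (ListP.filter-reject P? {xs = []} ¬PL))
           (ℚP.+-identityʳ (filteredSum L)))

  filteredSum-skip : ∀ a d → (∀ i → i < d → ¬ P (a ℕ.+ i)) → filteredSum (a ℕ.+ d) ≡ filteredSum a
  filteredSum-skip a zero    _    = cong filteredSum (ℕP.+-identityʳ a)
  filteredSum-skip a (suc d) miss = begin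
    filteredSum (a ℕ.+ suc d)    ≡⟨ cong filteredSum (ℕP.+-suc a d) ⟩
    filteredSum (suc (a ℕ.+ d))  ≡⟨ filteredSum-reject (miss d (ℕP.n<1+n d)) ⟩
    filteredSum (a ℕ.+ d)        ≡⟨ filteredSum-skip a d (λ i i<d → miss i (ℕP.m<n⇒m<1+n i<d)) ⟩
    filteredSum a                ∎
    where open ≡-Reasoning

  filteredSum-blocks : ∀ {M k} → k < M → (∀ j → P (j ℕ.* M ℕ.+ k)) →
    (∀ j {i} → i < M → i ≢ k → ¬ P (j ℕ.* M ℕ.+ i)) →
    ∀ j → filteredSum (j ℕ.* M) ≡ ∑< j (λ i → D (i ℕ.* M ℕ.+ k))
  filteredSum-blocks k<M hit miss zero = refl
  filteredSum-blocks {M} {k} k<M hit miss (suc j) = begin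
    filteredSum (suc j ℕ.* M)           ≡⟨ cong filteredSum split ⟩
    filteredSum (suc (jM ℕ.+ k) ℕ.+ d)  ≡⟨ filteredSum-skip (suc (jM ℕ.+ k)) d after ⟩
    filteredSum (suc (jM ℕ.+ k))        ≡⟨ filteredSum-accept (hit j) ⟩
    filteredSum (jM ℕ.+ k) + G j        ≡⟨ cong (_+ G j) (filteredSum-skip jM k before) ⟩
    filteredSum jM + G j                ≡⟨ cong (_+ G j) (filteredSum-blocks k<M hit miss j) ⟩
    ∑< j G + G j                        ≡⟨ sym (∑<-suc j G) ⟩
    ∑< (suc j) G                        ∎
    where
    open ≡-Reasoning
    jM d : ℕ
    jM = j ℕ.* M
    d = M ∸ suc k
    G : ℕ → ℚ
    G i = D (i ℕ.* M ℕ.+ k)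
    regroup : ∀ jM k d → suc k ℕ.+ d ℕ.+ jM ≡ suc (jM ℕ.+ k) ℕ.+ d
    regroup = ℕSolver.solve-∀
    split : suc j ℕ.* M ≡ suc (jM ℕ.+ k) ℕ.+ d
    split = trans (cong (ℕ._+ jM) (sym (ℕP.m+[n∸m]≡n k<M))) (regroup jM k d)
    before : ∀ i → i < k → ¬ P (jM ℕ.+ i)
    before i i<k = miss j (ℕP.<-trans i<k k<M) (λ i≡k → ℕP.<-irrefl i≡k i<k)
    reassoc : ∀ jM k i → jM ℕ.+ suc (k ℕ.+ i) ≡ suc (jM ℕ.+ k) ℕ.+ i
    reassoc = ℕSolver.solve-∀
    after : ∀ i → i < d → ¬ P (suc (jM ℕ.+ k) ℕ.+ i)
    after i i<d = subst (¬_ ∘ P) (reassoc jM k i)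
      (miss j (subst (suc (k ℕ.+ i) <_) (ℕP.m+[n∸m]≡n k<M) (ℕP.+-monoʳ-< (suc k) i<d))
              (λ k+1+i≡k → ℕP.m+1+n≢m k (trans (ℕP.+-suc k i) k+1+i≡k)))

∣+m-+n∣≡n∸m : ∀ {m n} → m ≤ n → ℤ.∣ + m ℤ.- + n ∣ ≡ n ∸ m
∣+m-+n∣≡n∸m {m} {n} m≤n = trans (cong ℤ.∣_∣ (ℤP.[+m]-[+n]≡m⊖n m n)) (ℤP.∣⊖∣-≤ m≤n)

∣+m-+n∣≡∣m-n∣ : ∀ m n → ℤ.∣ + m ℤ.- + n ∣ ≡ ℕ.∣ m - n ∣
∣+m-+n∣≡∣m-n∣ m n with ℕP.≤-total m n
... | inj₁ m≤n = trans (∣+m-+n∣≡n∸m m≤n) (sym (ℕP.m≤n⇒∣m-n∣≡n∸m m≤n))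
... | inj₂ n≤m = trans (ℤP.∣i-j∣≡∣j-i∣ (+ m) (+ n))
  (trans (∣+m-+n∣≡n∸m n≤m) (sym (trans (ℕP.∣-∣-comm m n) (ℕP.m≤n⇒∣m-n∣≡n∸m n≤m))))

∣-difference⇒≡ : ∀ {d m n} → m < d → n < d → + d ∣ (+ m ℤ.- + n) → m ≡ n
∣-difference⇒≡ {d} {m} {n} m<d n<d d∣m-n = ℕP.∣m-n∣≡0⇒m≡n (begin
  ℕ.∣ m - n ∣       ≡⟨ sym (ℕDM.m<n⇒m%n≡m ∣m-n∣<d) ⟩
  ℕ.∣ m - n ∣ ℕ.% d ≡⟨ ℕD.n∣m⇒m%n≡0 ℕ.∣ m - n ∣ d (subst (d ℕD.∣_) (∣+m-+n∣≡∣m-n∣ m n) d∣m-n) ⟩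
  0                 ∎)
  where
  open ≡-Reasoning
  instance
    d≢0 : NonZero d
    d≢0 = ℕ.>-nonZero (ℕP.≤-<-trans ℕ.z≤n m<d)
  ∣m-n∣<d : ℕ.∣ m - n ∣ < d
  ∣m-n∣<d = ℕP.≤-<-trans (ℕP.∣m-n∣≤m⊔n m n) (ℕP.⊔-lub m<d n<d)

-- With M = p^n, the cusp x/p^{n+1} lies over k/p^n under π_n.
LiesOver : ℕ → ℕ → ℕ → ℕ → Set
LiesOver p M k x = Coprime x p × + M ∣ (+ x ℤ.- + k)

module _ {p M k : ℕ} (p∣M : p ℕD.∣ M) (k<M : k < M) (k⊥p : Coprime k p) where

  jM+k-liesOver : ∀ j → LiesOver p M k (j ℕ.* M ℕ.+ k)
  jM+k-liesOver j = coprime , subst (+ M ∣_) (sym difference) (ℕD.n∣m*n j)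
    where
    coprime : Coprime (j ℕ.* M ℕ.+ k) p
    coprime (d∣jM+k , d∣p) =
      k⊥p (ℕD.∣m+n∣m⇒∣n d∣jM+k (ℕD.∣-trans d∣p (ℕD.∣-trans p∣M (ℕD.n∣m*n j))) , d∣p)
    cancel : ∀ a b → a ℤ.+ b ℤ.- b ≡ a
    cancel = solve-∀
    difference : + (j ℕ.* M ℕ.+ k) ℤ.- + k ≡ + (j ℕ.* M)
    difference = trans (cong (ℤ._- + k) (ℤP.pos-+ (j ℕ.* M) k)) (cancel (+ (j ℕ.* M)) (+ k))

  jM+i-¬liesOver : ∀ j {i} → i < M → i ≢ k → ¬ LiesOver p M k (j ℕ.* M ℕ.+ i)
  jM+i-¬liesOver j {i} i<M i≢k (_ , M∣jM+i-k) = i≢k (∣-difference⇒≡ i<M k<M (ℤS.∣⇒∣ᵤ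
    (ℤS.∣m+n∣n⇒∣m {m = + i ℤ.- + k} (subst (ℤS._∣_ (+ M)) difference (ℤS.∣ᵤ⇒∣ M∣jM+i-k))
                                    (ℤS.∣n⇒∣m*n (+ j) ℤS.∣-refl))))
    where
    regroup : ∀ j M i k → j ℤ.* M ℤ.+ i ℤ.- k ≡ (i ℤ.- k) ℤ.+ j ℤ.* M
    regroup = solve-∀
    difference : + (j ℕ.* M ℕ.+ i) ℤ.- + k ≡ (+ i ℤ.- + k) ℤ.+ + j ℤ.* + M
    difference = trans (cong (ℤ._- + k) (trans (ℤP.pos-+ (j ℕ.* M) i) (cong (ℤ._+ + i) (ℤP.pos-* j M))))
                       (regroup (+ j) (+ M) (+ i) (+ k))

π-fibre : ∀ p n D k → 1 ≤ n → k < p ^ n → Coprime k p →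
          π p n D k ≡ ∑< p (λ j → D (j ℕ.* p ^ n ℕ.+ k))
π-fibre p (suc n) D k (ℕ.s≤s ℕ.z≤n) k<M k⊥p =
  filteredSum-blocks k<M (jM+k-liesOver p∣M k<M k⊥p) (jM+i-¬liesOver p∣M k<M k⊥p) p
  where
  open FilteredSum (λ x → coprime? x p ×-dec (p ^ suc n ∣? ℤ.∣ + x ℤ.- + k ∣)) D
  p∣M : p ℕD.∣ p ^ suc n
  p∣M = ℕD.m∣m*n (p ^ n)

-- Orders of E_g^{(p^{n+1})} at the cusps over k/p^n

module _ (p : ℕ) (pp : Prime p) (n : ℕ) where

  private
    M : ℕ
    M = p ^ n
    instance
      p≢0 : NonZero p
      p≢0 = prime⇒nonZero pp
      M≢0 : NonZero M
      M≢0 = ℕP.m^n≢0 p n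
      pM≢0 : NonZero (p ℕ.* M)
      pM≢0 = ℕP.m^n≢0 p (suc n)

  divInf-suc-multiple : ∀ h j k →
    divInf p pp (suc n) (+ p *ℤ h) (j ℕ.* M ℕ.+ k) ≡ ι (+ p) * divInf p pp n h k
  divInf-suc-multiple h j k = begin
    + (p ℕ.* M) / 2 * B₂ ((+ (j ℕ.* M ℕ.+ k) *ℤ (+ p *ℤ h)) / (p ℕ.* M))
      ≡⟨ cong₂ _*_ ([mn]/2≡m*[n/2] p M) (cong B₂ rescale) ⟩
    ι (+ p) * (+ M / 2) * B₂ ((+ k *ℤ h ℤ.+ (+ j *ℤ h) *ℤ + M) / M)
      ≡⟨ cong (ι (+ p) * (+ M / 2) *_) (B₂-periodic (+ k *ℤ h) (+ j *ℤ h) M) ⟩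
    ι (+ p) * (+ M / 2) * B₂ ((+ k *ℤ h) / M)
      ≡⟨ ℚP.*-assoc (ι (+ p)) (+ M / 2) (B₂ ((+ k *ℤ h) / M)) ⟩
    ι (+ p) * divInf p pp n h k ∎
    where
    open ≡-Reasoning
    identity : ∀ j M k p h → (j *ℤ M ℤ.+ k) *ℤ (p *ℤ h) *ℤ M ≡ (k *ℤ h ℤ.+ j *ℤ h *ℤ M) *ℤ (p *ℤ M)
    identity = solve-∀
    rescale : (+ (j ℕ.* M ℕ.+ k) *ℤ (+ p *ℤ h)) / (p ℕ.* M) ≡ (+ k *ℤ h ℤ.+ (+ j *ℤ h) *ℤ + M) / M
    rescale = *≡*⇒/≡/ (+ (j ℕ.* M ℕ.+ k) *ℤ (+ p *ℤ h)) (+ k *ℤ h ℤ.+ (+ j *ℤ h) *ℤ + M) (p ℕ.* M) M (begin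
      + (j ℕ.* M ℕ.+ k) *ℤ (+ p *ℤ h) *ℤ + M
        ≡⟨ cong (λ z → z *ℤ (+ p *ℤ h) *ℤ + M) (trans (ℤP.pos-+ (j ℕ.* M) k) (cong (ℤ._+ + k) (ℤP.pos-* j M))) ⟩
      (+ j *ℤ + M ℤ.+ + k) *ℤ (+ p *ℤ h) *ℤ + M
        ≡⟨ identity (+ j) (+ M) (+ k) (+ p) h ⟩
      (+ k *ℤ h ℤ.+ + j *ℤ h *ℤ + M) *ℤ (+ p *ℤ + M)
        ≡⟨ cong (λ z → (+ k *ℤ h ℤ.+ + j *ℤ h *ℤ + M) *ℤ z) (sym (ℤP.pos-* p M)) ⟩
      (+ k *ℤ h ℤ.+ + j *ℤ h *ℤ + M) *ℤ + (p ℕ.* M) ∎)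

  π-divInf-multiple : 1 ≤ n → ∀ h k → k < M → Coprime k p →
    π p n (divInf p pp (suc n) (+ p *ℤ h)) k ≡ (+ (p ^ 2) / 1) * divInf p pp n h k
  π-divInf-multiple 1≤n h k k<M k⊥p = begin
    π p n (divInf p pp (suc n) (+ p *ℤ h)) k                     ≡⟨ π-fibre p n _ k 1≤n k<M k⊥p ⟩
    ∑< p (λ j → divInf p pp (suc n) (+ p *ℤ h) (j ℕ.* M ℕ.+ k))  ≡⟨ ∑<-cong p (λ j → divInf-suc-multiple h j k) ⟩
    ∑< p (λ _ → ι (+ p) * D)                                     ≡⟨ ∑<-const p (ι (+ p) * D) ⟩
    ι (+ p) * (ι (+ p) * D)                                      ≡⟨ sym (ℚP.*-assoc (ι (+ p)) (ι (+ p)) D) ⟩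
    ι (+ p) * ι (+ p) * D                                        ≡⟨ cong (_* D) p*p≡p² ⟩
    (+ (p ^ 2) / 1) * D                                          ∎
    where
    open ≡-Reasoning
    D : ℚ
    D = divInf p pp n h k
    p*p≡p² : ι (+ p) * ι (+ p) ≡ + (p ^ 2) / 1
    p*p≡p² = trans (/-*-/ (+ p) (+ p) 1 1)
      (cong (_/ 1) (trans (sym (ℤP.pos-* p p)) (cong (λ m → + (p ℕ.* m)) (sym (ℕP.*-identityʳ p)))))

  module _ (g : ℤ) (k : ℕ) where

    private
      s : ℕ
      s = (+ k *ℤ g) ℤD.%ℕ M
      q : ℤ
      q = (+ k *ℤ g) ℤD./ℕ M
      τ : ℕ → ℕ
      τ j = (q ℤ.+ + j *ℤ g) ℤD.%ℕ p
      u : ℕ → ℤ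
      u j = (q ℤ.+ + j *ℤ g) ℤD./ℕ p
      kg≡s+qM : + k *ℤ g ≡ + s ℤ.+ q *ℤ + M
      kg≡s+qM = ℤD.a≡a%ℕn+[a/ℕn]*n (+ k *ℤ g) M
      q+jg≡τ+up : ∀ j → q ℤ.+ + j *ℤ g ≡ + τ j ℤ.+ u j *ℤ + p
      q+jg≡τ+up j = ℤD.a≡a%ℕn+[a/ℕn]*n (q ℤ.+ + j *ℤ g) p

    lift-numerator : ∀ j → + (j ℕ.* M ℕ.+ k) *ℤ g ≡ + (s ℕ.+ τ j ℕ.* M) ℤ.+ u j *ℤ + (p ℕ.* M)
    lift-numerator j = begin
      + (j ℕ.* M ℕ.+ k) *ℤ g
        ≡⟨ cong (_*ℤ g) (trans (ℤP.pos-+ (j ℕ.* M) k) (cong (ℤ._+ + k) (ℤP.pos-* j M))) ⟩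
      (+ j *ℤ + M ℤ.+ + k) *ℤ g                    ≡⟨ expand (+ j) (+ M) (+ k) g ⟩
      + k *ℤ g ℤ.+ + j *ℤ g *ℤ + M                 ≡⟨ cong (ℤ._+ + j *ℤ g *ℤ + M) kg≡s+qM ⟩
      + s ℤ.+ q *ℤ + M ℤ.+ + j *ℤ g *ℤ + M         ≡⟨ collect (+ s) q (+ M) (+ j *ℤ g) ⟩
      + s ℤ.+ (q ℤ.+ + j *ℤ g) *ℤ + M              ≡⟨ cong (λ z → + s ℤ.+ z *ℤ + M) (q+jg≡τ+up j) ⟩
      + s ℤ.+ (+ τ j ℤ.+ u j *ℤ + p) *ℤ + M        ≡⟨ distribute (+ s) (+ τ j) (u j) (+ p) (+ M) ⟩
      + s ℤ.+ + τ j *ℤ + M ℤ.+ u j *ℤ (+ p *ℤ + M)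
        ≡⟨ sym (cong₂ (λ a b → a ℤ.+ u j *ℤ b)
                 (trans (ℤP.pos-+ s (τ j ℕ.* M)) (cong (λ z → + s ℤ.+ z) (ℤP.pos-* (τ j) M)))
                 (ℤP.pos-* p M)) ⟩
      + (s ℕ.+ τ j ℕ.* M) ℤ.+ u j *ℤ + (p ℕ.* M)   ∎
      where
      open ≡-Reasoning
      expand : ∀ j M k g → (j *ℤ M ℤ.+ k) *ℤ g ≡ k *ℤ g ℤ.+ j *ℤ g *ℤ M
      expand = solve-∀
      collect : ∀ s q M x → s ℤ.+ q *ℤ M ℤ.+ x *ℤ M ≡ s ℤ.+ (q ℤ.+ x) *ℤ M
      collect = solve-∀
      distribute : ∀ s t u p M → s ℤ.+ (t ℤ.+ u *ℤ p) *ℤ M ≡ s ℤ.+ t *ℤ M ℤ.+ u *ℤ (p *ℤ M)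
      distribute = solve-∀

    divInf-suc-coprime : ∀ j → divInf p pp (suc n) g (j ℕ.* M ℕ.+ k) ≡
      ι (+ p) * (+ M / 2) * bernoulli₂ ((+ s / M + ι (+ τ j)) * (+ 1 / p))
    divInf-suc-coprime j = cong₂ _*_ ([mn]/2≡m*[n/2] p M) (begin
      B₂ ((+ (j ℕ.* M ℕ.+ k) *ℤ g) / (p ℕ.* M))
        ≡⟨ B₂-/ (+ (j ℕ.* M ℕ.+ k) *ℤ g) (u j) (s ℕ.+ τ j ℕ.* M) (p ℕ.* M) s+τM<pM (lift-numerator j) ⟩
      bernoulli₂ (+ (s ℕ.+ τ j ℕ.* M) / (p ℕ.* M))
        ≡⟨ cong bernoulli₂ ([s+tM]/[pM]≡[s/M+t]/p p M s (τ j)) ⟩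
      bernoulli₂ ((+ s / M + ι (+ τ j)) * (+ 1 / p)) ∎)
      where
      open ≡-Reasoning
      s+τM<pM : s ℕ.+ τ j ℕ.* M < p ℕ.* M
      s+τM<pM = ℕP.<-≤-trans (ℕP.+-monoˡ-< (τ j ℕ.* M) (ℤD.n%ℕd<d (+ k *ℤ g) M))
                              (ℕP.*-monoˡ-≤ M (ℤD.n%ℕd<d (q ℤ.+ + j *ℤ g) p))

    τ-injective : ¬ (+ p ∣ g) → ∀ {j j′} → j < p → j′ < p → τ j ≡ τ j′ → j ≡ j′
    τ-injective p∤g {j} {j′} j<p j′<p τj≡τj′ with euclidsLemma ℤ.∣ + j ℤ.- + j′ ∣ ℤ.∣ g ∣ pp p∣[j-j′]g
      where
      cancel-q : ∀ j j′ g q → (j ℤ.- j′) *ℤ g ≡ (q ℤ.+ j *ℤ g) ℤ.- (q ℤ.+ j′ *ℤ g)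
      cancel-q = solve-∀
      cancel-τ : ∀ t u u′ p → (t ℤ.+ u *ℤ p) ℤ.- (t ℤ.+ u′ *ℤ p) ≡ (u ℤ.- u′) *ℤ p
      cancel-τ = solve-∀
      difference : (+ j ℤ.- + j′) *ℤ g ≡ (u j ℤ.- u j′) *ℤ + p
      difference = begin
        (+ j ℤ.- + j′) *ℤ g                                    ≡⟨ cancel-q (+ j) (+ j′) g q ⟩
        (q ℤ.+ + j *ℤ g) ℤ.- (q ℤ.+ + j′ *ℤ g)                 ≡⟨ cong₂ ℤ._-_ (q+jg≡τ+up j) (q+jg≡τ+up j′) ⟩
        (+ τ j ℤ.+ u j *ℤ + p) ℤ.- (+ τ j′ ℤ.+ u j′ *ℤ + p)
          ≡⟨ cong (λ t → (+ τ j ℤ.+ u j *ℤ + p) ℤ.- (+ t ℤ.+ u j′ *ℤ + p)) (sym τj≡τj′) ⟩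
        (+ τ j ℤ.+ u j *ℤ + p) ℤ.- (+ τ j ℤ.+ u j′ *ℤ + p)    ≡⟨ cancel-τ (+ τ j) (u j) (u j′) (+ p) ⟩
        (u j ℤ.- u j′) *ℤ + p                                  ∎
        where open ≡-Reasoning
      p∣[j-j′]g : p ℕD.∣ ℤ.∣ + j ℤ.- + j′ ∣ ℕ.* ℤ.∣ g ∣
      p∣[j-j′]g = ℕD.divides ℤ.∣ u j ℤ.- u j′ ∣ (begin
        ℤ.∣ + j ℤ.- + j′ ∣ ℕ.* ℤ.∣ g ∣  ≡⟨ sym (ℤP.abs-* (+ j ℤ.- + j′) g) ⟩
        ℤ.∣ (+ j ℤ.- + j′) *ℤ g ∣       ≡⟨ cong ℤ.∣_∣ difference ⟩
        ℤ.∣ (u j ℤ.- u j′) *ℤ + p ∣     ≡⟨ ℤP.abs-* (u j ℤ.- u j′) (+ p) ⟩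
        ℤ.∣ u j ℤ.- u j′ ∣ ℕ.* p         ∎)
        where open ≡-Reasoning
    ... | inj₁ p∣j-j′ = ∣-difference⇒≡ j<p j′<p p∣j-j′
    ... | inj₂ p∣g    = contradiction p∣g p∤g

    π-divInf-coprime : ¬ (+ p ∣ g) → 1 ≤ n → k < M → Coprime k p →
      π p n (divInf p pp (suc n) g) k ≡ divInf p pp n g k
    π-divInf-coprime p∤g 1≤n k<M k⊥p = begin
      π p n (divInf p pp (suc n) g) k
        ≡⟨ π-fibre p n _ k 1≤n k<M k⊥p ⟩
      ∑< p (λ j → divInf p pp (suc n) g (j ℕ.* M ℕ.+ k))
        ≡⟨ ∑<-cong p divInf-suc-coprime ⟩
      ∑< p (λ j → c * f (τ j))
        ≡⟨ ∑<-permute p (λ t → c * f t) τ τ<p (τ-injective p∤g) ⟩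
      ∑< p (λ t → c * f t)
        ≡⟨ sym (*-distribˡ-∑< p c f) ⟩
      ι (+ p) * H * ∑< p f
        ≡⟨ cong (_* ∑< p f) (ℚP.*-comm (ι (+ p)) H) ⟩
      H * ι (+ p) * ∑< p f
        ≡⟨ ℚP.*-assoc H (ι (+ p)) (∑< p f) ⟩
      H * (ι (+ p) * ∑< p f)
        ≡⟨ cong (H *_) (bernoulli₂-multiplication p (+ s / M) (+ 1 / p) (n*[1/n]≡1 p)) ⟩
      H * bernoulli₂ (+ s / M)
        ≡⟨ cong (H *_) (sym (B₂-/ (+ k *ℤ g) q s M (ℤD.n%ℕd<d (+ k *ℤ g) M) kg≡s+qM)) ⟩
      divInf p pp n g k ∎
      where
      open ≡-Reasoning
      H c : ℚ
      H = + M / 2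
      c = ι (+ p) * H
      f : ℕ → ℚ
      f t = bernoulli₂ ((+ s / M + ι (+ t)) * (+ 1 / p))
      τ<p : ∀ j → j < p → τ j < p
      τ<p j _ = ℤD.n%ℕd<d (q ℤ.+ + j *ℤ g) p

-- The hypothesis p^{n+1} ∤ g only ensures that E_g^{(p^{n+1})} is defined.
lemma5 : (p : ℕ) (pp : Prime p) (n : ℕ) → 1 ≤ n → (g : ℤ) → ¬ (+ (p ^ suc n) ∣ g) →
    ((¬ (+ p ∣ g)) →
      ∀ k → k < p ^ n → Coprime k p →
        π p n (divInf p pp (suc n) g) k ≡ divInf p pp n g k)
    × ((h : ℤ) → g ≡ + p *ℤ h →
      ∀ k → k < p ^ n → Coprime k p →
        π p n (divInf p pp (suc n) g) k ≡ (+ (p ^ 2) / 1) * divInf p pp n h k)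
lemma5 p pp n 1≤n g _ = coprime-case , multiple-case
  where
  coprime-case : ¬ (+ p ∣ g) → ∀ k → k < p ^ n → Coprime k p →
    π p n (divInf p pp (suc n) g) k ≡ divInf p pp n g k
  coprime-case p∤g k = π-divInf-coprime p pp n g k p∤g 1≤n
  multiple-case : (h : ℤ) → g ≡ + p *ℤ h → ∀ k → k < p ^ n → Coprime k p →
    π p n (divInf p pp (suc n) g) k ≡ (+ (p ^ 2) / 1) * divInf p pp n h k
  multiple-case h refl = π-divInf-multiple p pp n 1≤n h
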